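{- If $\dot G\in\mathcal{C}_1\cup\mathcal{C}_4\cup\mathcal{C}_5$ is a connected, non-complete, $5$-regular and $1$ net-regular strongly regular signed graph with parameters $(n,5,a,b,c)$, then $(a,b)\neq(1,0)$.
   Context: A signed graph $\dot G=(G,\sigma)$ is a simple graph $G$ (its underlying graph) with a sign function $\sigma:E(G)\to\{+1,-1\}$; its adjacency matrix $A_{\dot G}$ has $(i,j)$ entry $\sigma(v_iv_j)$ if $v_i\sim v_j$ and $0$ otherwise. Degree is the degree in $G$; $d^\pm(v)$ are the numbers of positive/negative edges at $v$; the net-degree is $d^+(v)-d^-(v)$, and $\dot G$ is $\rho$ net-regular if all net-degrees equal $\rho$. Connected/complete refer to $G$. $\dot G$ is homogeneous if all edges have the same sign, inhomogeneous otherwise. A signed graph on $n$ vertices is strongly regular (SRSG) if it is neither homogeneous complete nor edgeless and there are $r\in\mathbb N$, $a,b,c\in\mathbb Z$ with $(A^2_{\dot G})_{ii}=r$, $(A^2_{\dot G})_{ij}=a$ for positive edges $v_iv_j$, $=b$ for negative edges, $=c$ for distinct non-adjacent $v_i,v_j$; parameters $(n,r,a,b,c)$. Inhomogeneous SRSGs are divided into classes: $\mathcal{C}_1$: $a=-b$, and either complete or non-complete with $c\neq 0$; $\mathcal{C}_4$: $a\neq -b$, non-complete with $c=0$; $\mathcal{C}_5$: $a\ne -b$, non-complete with $c\neq\frac{a+b}{2}$ and $c\neq 0$. -}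

module Defs where

open import Data.Nat using (ℕ; zero; suc)
open import Data.Fin using (Fin)
import Data.Fin as F
open import Data.Integer using (ℤ; +_; -_; _+_; _*_; 0ℤ; 1ℤ; -1ℤ)
open import Data.Product using (_×_)
open import Data.Sum using (_⊎_)
open import Relation.Binary.PropositionalEquality using (_≡_; _≢_)
open import Relation.Nullary using (¬_; yes; no)
open import Data.Integer using (_≟_)

∑ : ∀ {n} → (Fin n → ℤ) → ℤ
∑ {zero}  f = 0ℤ
∑ {suc n} f = f F.zero + ∑ (λ k → f (F.suc k))

Adj : ℕ → Set
Adj n = Fin n → Fin n → ℤ

record IsSignedGraph {n : ℕ} (A : Adj n) : Set where
  field
    entries : ∀ i j → (A i j ≡ 0ℤ) ⊎ ((A i j ≡ 1ℤ) ⊎ (A i j ≡ -1ℤ))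
    symm    : ∀ i j → A i j ≡ A j i
    loopless : ∀ i → A i i ≡ 0ℤ

sq : ∀ {n} → Adj n → Fin n → Fin n → ℤ
sq A i j = ∑ (λ k → A i k * A k j)

ind : ℤ → ℤ → ℤ
ind v x with x ≟ v
... | yes _ = 1ℤ
... | no _  = 0ℤ

deg : ∀ {n} → Adj n → Fin n → ℤ
deg A i = ∑ (λ k → ind 1ℤ (A i k) + ind -1ℤ (A i k))

dpos dneg netdeg : ∀ {n} → Adj n → Fin n → ℤ
dpos A i = ∑ (λ k → ind 1ℤ (A i k))
dneg A i = ∑ (λ k → ind -1ℤ (A i k))
netdeg A i = dpos A i + (- dneg A i)

Regular : ∀ {n} → Adj n → ℤ → Set
Regular A k = ∀ i → deg A i ≡ k

NetRegular : ∀ {n} → Adj n → ℤ → Set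
NetRegular A ρ = ∀ i → netdeg A i ≡ ρ

data Reach {n} (A : Adj n) (i : Fin n) : Fin n → Set where
  here : Reach A i i
  step : ∀ {k j} → Reach A i k → A k j ≢ 0ℤ → Reach A i j

Connected : ∀ {n} → Adj n → Set
Connected A = ∀ i j → Reach A i j

Complete : ∀ {n} → Adj n → Set
Complete A = ∀ i j → i ≢ j → A i j ≢ 0ℤ

Edgeless : ∀ {n} → Adj n → Set
Edgeless A = ∀ i j → A i j ≡ 0ℤ

Homogeneous : ∀ {n} → Adj n → Set
Homogeneous A = (∀ i j → A i j ≢ -1ℤ) ⊎ (∀ i j → A i j ≢ 1ℤ)

Inhomogeneous : ∀ {n} → Adj n → Set
Inhomogeneous A = ¬ Homogeneous A

record IsSRSG {n : ℕ} (A : Adj n) (r : ℕ) (a b c : ℤ) : Set where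
  field
    signed       : IsSignedGraph A
    notHomCompl  : ¬ (Homogeneous A × Complete A)
    notEdgeless  : ¬ Edgeless A
    diag         : ∀ i → sq A i i ≡ + r
    posEdge      : ∀ i j → A i j ≡ 1ℤ → sq A i j ≡ a
    negEdge      : ∀ i j → A i j ≡ -1ℤ → sq A i j ≡ b
    nonAdj       : ∀ i j → i ≢ j → A i j ≡ 0ℤ → sq A i j ≡ c

C₁ C₄ C₅ : ∀ {n} → Adj n → ℤ → ℤ → ℤ → Set
C₁ A a b c = (a ≡ - b) × (Complete A ⊎ (¬ Complete A × c ≢ 0ℤ))
C₄ A a b c = (a ≢ - b) × (¬ Complete A × c ≡ 0ℤ)
-- c ≠ (a+b)/2 stated as 2c ≠ a + b (c integer)
C₅ A a b c = (a ≢ - b) × (¬ Complete A × ((+ 2) * c ≢ a + b × c ≢ 0ℤ))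

-- Sum row v of A² in two ways. Every row of A sums to the net degree 1, so every row of A²
-- sums to 1 · 1 = 1. Counting by the parameters instead, with d⁺ = 3 and d⁻ = 2 forced by
-- degree 5 and net degree 1, the row sum is r + a d⁺ + b d⁻ + c (n − 1 − 5) = 8 + c (n − 6).
-- Hence c (n − 6) = −7; but a 5-regular graph has even order by the handshake lemma.
module Submission where

open import Defs
open import Data.Nat using (ℕ; zero; suc)
import Data.Nat.Properties as ℕ
open import Data.Integer using (ℤ; +_; -_; _+_; _-_; _*_; 0ℤ; 1ℤ; -1ℤ; ∣_∣)
open import Data.Integer.Properties
  using (+-0-commutativeMonoid; +-*-semiring; +-identityˡ; *-comm; *-zeroʳ; *-suc; *-identityʳ; -1*i≡-i; *-cancelˡ-≡; abs-*)
open import Data.Integer.Tactic.RingSolver using (solve-∀)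
open import Data.Fin using (Fin; zero; suc)
import Data.Fin as F
open import Data.Empty using (⊥-elim)
open import Data.Product using (_,_; proj₁; proj₂; ∃-syntax)
open import Data.Sum using (_⊎_; inj₁; inj₂)
open import Relation.Binary.PropositionalEquality
  using (_≡_; _≢_; refl; sym; trans; cong; cong₂; module ≡-Reasoning)
open import Relation.Nullary using (¬_; yes; no)
import Algebra.Properties.CommutativeMonoid.Sum +-0-commutativeMonoid as Sum
import Algebra.Properties.Semiring.Sum +-*-semiring as SemiringSum

open ≡-Reasoning

∑≡sum : ∀ {n} (f : Fin n → ℤ) → ∑ f ≡ Sum.sum f
∑≡sum {zero}  f = refl
∑≡sum {suc n} f = cong (_+_ (f zero)) (∑≡sum (λ k → f (suc k)))

∑-cong : ∀ {n} {f g : Fin n → ℤ} → (∀ k → f k ≡ g k) → ∑ f ≡ ∑ g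
∑-cong {f = f} {g} f≗g = trans (∑≡sum f) (trans (Sum.sum-cong-≗ f≗g) (sym (∑≡sum g)))

∑-distrib-+ : ∀ {n} (f g : Fin n → ℤ) → ∑ (λ k → f k + g k) ≡ ∑ f + ∑ g
∑-distrib-+ f g = begin
  ∑ (λ k → f k + g k)          ≡⟨ ∑≡sum (λ k → f k + g k) ⟩
  Sum.sum (λ k → f k + g k)    ≡⟨ Sum.∑-distrib-+ f g ⟩
  Sum.sum f + Sum.sum g        ≡⟨ sym (cong₂ _+_ (∑≡sum f) (∑≡sum g)) ⟩
  ∑ f + ∑ g                    ∎

∑-distribˡ-* : ∀ {n} x (f : Fin n → ℤ) → ∑ (λ k → x * f k) ≡ x * ∑ f
∑-distribˡ-* x f = begin
  ∑ (λ k → x * f k)          ≡⟨ ∑≡sum (λ k → x * f k) ⟩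
  Sum.sum (λ k → x * f k)    ≡⟨ sym (SemiringSum.*-distribˡ-sum x f) ⟩
  x * Sum.sum f              ≡⟨ sym (cong (x *_) (∑≡sum f)) ⟩
  x * ∑ f                    ∎

∑-comm : ∀ {m n} (f : Fin m → Fin n → ℤ) → ∑ (λ i → ∑ (f i)) ≡ ∑ (λ j → ∑ (λ i → f i j))
∑-comm f = begin
  ∑ (λ i → ∑ (f i))                        ≡⟨ ∑-cong (λ i → ∑≡sum (f i)) ⟩
  ∑ (λ i → Sum.sum (f i))                  ≡⟨ ∑≡sum (λ i → Sum.sum (f i)) ⟩
  Sum.sum (λ i → Sum.sum (f i))            ≡⟨ Sum.∑-comm f ⟩
  Sum.sum (λ j → Sum.sum (λ i → f i j))    ≡⟨ sym (∑≡sum (λ j → Sum.sum (λ i → f i j))) ⟩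
  ∑ (λ j → Sum.sum (λ i → f i j))          ≡⟨ sym (∑-cong (λ j → ∑≡sum (λ i → f i j))) ⟩
  ∑ (λ j → ∑ (λ i → f i j))                ∎

∑-const : ∀ n x → ∑ {n} (λ _ → x) ≡ x * + n
∑-const zero    x = sym (*-zeroʳ x)
∑-const (suc n) x = trans (cong (_+_ x) (∑-const n x)) (sym (*-suc x (+ n)))

∑-+-* : ∀ {n} (f : Fin n → ℤ) x (g : Fin n → ℤ) → ∑ (λ k → f k + x * g k) ≡ ∑ f + x * ∑ g
∑-+-* f x g = trans (∑-distrib-+ f (λ k → x * g k)) (cong (_+_ (∑ f)) (∑-distribˡ-* x g))

δ : ∀ {n} → Fin n → Fin n → ℤ
δ zero    zero    = 1ℤ
δ zero    (suc _) = 0ℤ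
δ (suc _) zero    = 0ℤ
δ (suc i) (suc j) = δ i j

δ-diag : ∀ {n} (i : Fin n) → δ i i ≡ 1ℤ
δ-diag zero    = refl
δ-diag (suc i) = δ-diag i

δ-offdiag : ∀ {n} {i j : Fin n} → i ≢ j → δ i j ≡ 0ℤ
δ-offdiag {i = zero}  {zero}  i≢j = ⊥-elim (i≢j refl)
δ-offdiag {i = zero}  {suc j} i≢j = refl
δ-offdiag {i = suc i} {zero}  i≢j = refl
δ-offdiag {i = suc i} {suc j} i≢j = δ-offdiag (λ i≡j → i≢j (cong suc i≡j))

∑-δ : ∀ {n} (i : Fin n) → ∑ (δ i) ≡ 1ℤ
∑-δ {suc n} zero    = cong (_+_ 1ℤ) (∑-const n 0ℤ)
∑-δ {suc n} (suc i) = trans (+-identityˡ (∑ (δ i))) (∑-δ i)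

-- Row 0 and column 0 contribute the same sum s, and the corner f 0 0 vanishes.
handshake : ∀ {n} (f : Fin n → Fin n → ℤ) → (∀ i j → f i j ≡ f j i) → (∀ i → f i i ≡ 0ℤ) →
            ∃[ e ] ∑ (λ i → ∑ (f i)) ≡ e + e
handshake {zero}  f _    _     = 0ℤ , refl
handshake {suc n} f symm diag0
  with handshake (λ i j → f (suc i) (suc j)) (λ i j → symm (suc i) (suc j)) (λ i → diag0 (suc i))
... | e , inner = s + e , (begin
    f zero zero + s + ∑ (λ i → f (suc i) zero + ∑ (λ j → f (suc i) (suc j)))
      ≡⟨ cong₂ _+_ (cong (_+ s) (diag0 zero))
                   (∑-distrib-+ (λ i → f (suc i) zero) (λ i → ∑ (λ j → f (suc i) (suc j)))) ⟩
    0ℤ + s + (∑ (λ i → f (suc i) zero) + ∑ (λ i → ∑ (λ j → f (suc i) (suc j))))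
      ≡⟨ cong₂ (λ u v → 0ℤ + s + (u + v)) (∑-cong (λ i → symm (suc i) zero)) inner ⟩
    0ℤ + s + (s + (e + e))
      ≡⟨ regroup s e ⟩
    s + e + (s + e) ∎)
  where
  s : ℤ
  s = ∑ (λ j → f zero (suc j))
  regroup : ∀ s e → 0ℤ + s + (s + (e + e)) ≡ s + e + (s + e)
  regroup = solve-∀

signed-entry≡ind : ∀ {x} → (x ≡ 0ℤ) ⊎ ((x ≡ 1ℤ) ⊎ (x ≡ -1ℤ)) → x ≡ ind 1ℤ x + -1ℤ * ind -1ℤ x
signed-entry≡ind (inj₁ refl)        = refl
signed-entry≡ind (inj₂ (inj₁ refl)) = refl
signed-entry≡ind (inj₂ (inj₂ refl)) = refl

deg≡dpos+dneg : ∀ {n} (A : Adj n) i → deg A i ≡ dpos A i + dneg A i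
deg≡dpos+dneg A i = ∑-distrib-+ (λ k → ind 1ℤ (A i k)) (λ k → ind -1ℤ (A i k))

2*dpos≡deg+netdeg : ∀ {n} (A : Adj n) i → + 2 * dpos A i ≡ deg A i + netdeg A i
2*dpos≡deg+netdeg A i = begin
  + 2 * dpos A i                                ≡⟨ split (dpos A i) (dneg A i) ⟩
  dpos A i + dneg A i + netdeg A i              ≡⟨ cong (_+ netdeg A i) (sym (deg≡dpos+dneg A i)) ⟩
  deg A i + netdeg A i                          ∎
  where
  split : ∀ p m → + 2 * p ≡ p + m + (p + - m)
  split = solve-∀

2*dneg≡deg-netdeg : ∀ {n} (A : Adj n) i → + 2 * dneg A i ≡ deg A i - netdeg A i
2*dneg≡deg-netdeg A i = begin
  + 2 * dneg A i                                ≡⟨ split (dpos A i) (dneg A i) ⟩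
  dpos A i + dneg A i - netdeg A i              ≡⟨ cong (_- netdeg A i) (sym (deg≡dpos+dneg A i)) ⟩
  deg A i - netdeg A i                          ∎
  where
  split : ∀ p m → + 2 * m ≡ p + m - (p + - m)
  split = solve-∀

∑-deg-regular : ∀ {n} (A : Adj n) {k} → Regular A k → ∑ (deg A) ≡ k * + n
∑-deg-regular {n} A {k} regular = trans (∑-cong regular) (∑-const n k)

module _ {n} {A : Adj n} (G : IsSignedGraph A) where
  open IsSignedGraph G

  row-sum≡netdeg : ∀ i → ∑ (A i) ≡ netdeg A i
  row-sum≡netdeg i = begin
    ∑ (A i)                                             ≡⟨ ∑-cong (λ j → signed-entry≡ind (entries i j)) ⟩
    ∑ (λ j → ind 1ℤ (A i j) + -1ℤ * ind -1ℤ (A i j))    ≡⟨ ∑-+-* (λ j → ind 1ℤ (A i j)) -1ℤ (λ j → ind -1ℤ (A i j)) ⟩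
    dpos A i + -1ℤ * dneg A i                           ≡⟨ cong (_+_ (dpos A i)) (-1*i≡-i (dneg A i)) ⟩
    netdeg A i                                          ∎

  degree-sum-even : ∃[ e ] ∑ (deg A) ≡ e + e
  degree-sum-even = handshake (λ i j → ind 1ℤ (A i j) + ind -1ℤ (A i j))
                              (λ i j → cong (λ x → ind 1ℤ x + ind -1ℤ x) (symm i j))
                              (λ i → cong (λ x → ind 1ℤ x + ind -1ℤ x) (loopless i))

  odd-regular⇒even-order : ∀ t → Regular A (1ℤ + + 2 * t) → ∃[ h ] + n ≡ + 2 * h
  odd-regular⇒even-order t regular with degree-sum-even
  ... | e , degrees = e - t * + n , (begin
    + n                                      ≡⟨ peel (+ n) t ⟩
    (1ℤ + + 2 * t) * + n - + 2 * (t * + n)   ≡⟨ cong (_- + 2 * (t * + n)) (sym (∑-deg-regular A regular)) ⟩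
    ∑ (deg A) - + 2 * (t * + n)              ≡⟨ cong (_- + 2 * (t * + n)) degrees ⟩
    e + e - + 2 * (t * + n)                  ≡⟨ factor e (t * + n) ⟩
    + 2 * (e - t * + n)                      ∎)
    where
    peel : ∀ x t → x ≡ (1ℤ + + 2 * t) * x - + 2 * (t * x)
    peel = solve-∀
    factor : ∀ e y → e + e - + 2 * y ≡ + 2 * (e - y)
    factor = solve-∀

∑-sq-row : ∀ {n} (A : Adj n) ρ → (∀ k → ∑ (A k) ≡ ρ) → ∀ i → ∑ (sq A i) ≡ ρ * ρ
∑-sq-row A ρ rows i = begin
  ∑ (λ j → ∑ (λ k → A i k * A k j))   ≡⟨ ∑-comm (λ j k → A i k * A k j) ⟩
  ∑ (λ k → ∑ (λ j → A i k * A k j))   ≡⟨ ∑-cong (λ k → ∑-distribˡ-* (A i k) (A k)) ⟩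
  ∑ (λ k → A i k * ∑ (A k))           ≡⟨ ∑-cong (λ k → trans (cong (A i k *_) (rows k)) (*-comm (A i k) ρ)) ⟩
  ∑ (λ k → ρ * A i k)                 ≡⟨ ∑-distribˡ-* ρ (A i) ⟩
  ρ * ∑ (A i)                         ≡⟨ cong (ρ *_) (rows i) ⟩
  ρ * ρ                               ∎

module _ {n r a b c} {A : Adj n} (S : IsSRSG A r a b c) where
  open IsSRSG S
  open IsSignedGraph signed

  sq-profile : ∀ i j → sq A i j ≡ c + (+ r - c) * δ i j + (a - c) * ind 1ℤ (A i j) + (b - c) * ind -1ℤ (A i j)
  sq-profile i j with i F.≟ j
  ... | yes refl rewrite δ-diag i | loopless i = trans (diag i) (at-diagonal (+ r) c a b)
    where
    at-diagonal : ∀ r c a b → r ≡ c + (r - c) * 1ℤ + (a - c) * 0ℤ + (b - c) * 0ℤ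
    at-diagonal = solve-∀
  ... | no i≢j rewrite δ-offdiag i≢j with entries i j
  ...   | inj₁ e rewrite e = trans (nonAdj i j i≢j e) (at-non-neighbour (+ r) c a b)
    where
    at-non-neighbour : ∀ r c a b → c ≡ c + (r - c) * 0ℤ + (a - c) * 0ℤ + (b - c) * 0ℤ
    at-non-neighbour = solve-∀
  ...   | inj₂ (inj₁ e) rewrite e = trans (posEdge i j e) (at-positive (+ r) c a b)
    where
    at-positive : ∀ r c a b → a ≡ c + (r - c) * 0ℤ + (a - c) * 1ℤ + (b - c) * 0ℤ
    at-positive = solve-∀
  ...   | inj₂ (inj₂ e) rewrite e = trans (negEdge i j e) (at-negative (+ r) c a b)
    where
    at-negative : ∀ r c a b → b ≡ c + (r - c) * 0ℤ + (a - c) * 0ℤ + (b - c) * 1ℤ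
    at-negative = solve-∀

  srsg-row-sum : ∀ i → ∑ (sq A i) ≡ c * + n + (+ r - c) + (a - c) * dpos A i + (b - c) * dneg A i
  srsg-row-sum i = begin
    ∑ (sq A i)                                            ≡⟨ ∑-cong (sq-profile i) ⟩
    ∑ (λ j → c + R * δ i j + α * I⁺ j + β * I⁻ j)         ≡⟨ ∑-+-* (λ j → c + R * δ i j + α * I⁺ j) β I⁻ ⟩
    ∑ (λ j → c + R * δ i j + α * I⁺ j) + β * dneg A i     ≡⟨ cong (_+ β * dneg A i) (∑-+-* (λ j → c + R * δ i j) α I⁺) ⟩
    ∑ (λ j → c + R * δ i j) + α * dpos A i + β * dneg A i ≡⟨ cong (λ s → s + α * dpos A i + β * dneg A i)
                                                                  (∑-+-* (λ _ → c) R (δ i)) ⟩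
    ∑ {n} (λ _ → c) + R * ∑ (δ i) + α * dpos A i + β * dneg A i
                                                          ≡⟨ cong₂ (λ s t → s + t + α * dpos A i + β * dneg A i)
                                                                   (∑-const n c) (trans (cong (R *_) (∑-δ i)) (*-identityʳ R)) ⟩
    c * + n + R + α * dpos A i + β * dneg A i             ∎
    where
    R α β : ℤ
    R = + r - c
    α = a - c
    β = b - c
    I⁺ I⁻ : Fin n → ℤ
    I⁺ j = ind 1ℤ (A i j)
    I⁻ j = ind -1ℤ (A i j)

2*i≢1 : ∀ i → + 2 * i ≢ 1ℤ
2*i≢1 i 2i≡1 with ℕ.m*n≡1⇒m≡1 2 ∣ i ∣ (trans (sym (abs-* (+ 2) i)) (cong ∣_∣ 2i≡1))
... | ()

lemma3p7 : (n : ℕ) (A : Adj n) (a b c : ℤ) →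
    IsSRSG A 5 a b c → Inhomogeneous A →
    (C₁ A a b c ⊎ (C₄ A a b c ⊎ C₅ A a b c)) →
    Connected A → ¬ Complete A →
    Regular A (+ 5) → NetRegular A 1ℤ →
    ¬ ((a , b) ≡ (1ℤ , 0ℤ))
lemma3p7 zero    A a b c srsg _ _ _ _ _ _ _ = IsSRSG.notEdgeless srsg (λ ())
lemma3p7 (suc n) A .1ℤ .0ℤ c srsg _ _ _ _ regular net-regular refl =
  2*i≢1 (c * h - + 3 * c + + 4) (begin
    + 2 * (c * h - + 3 * c + + 4)                                         ≡⟨ expand c h ⟩
    c * (+ 2 * h) + (+ 5 - c) + (1ℤ - c) * + 3 + (0ℤ - c) * + 2           ≡⟨ sym (cong₂ _+_ (cong₂ _+_
                                                                               (cong (λ x → c * x + (+ 5 - c)) even-order)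
                                                                               (cong ((1ℤ - c) *_) dpos≡3))
                                                                               (cong ((0ℤ - c) *_) dneg≡2)) ⟩
    c * + suc n + (+ 5 - c) + (1ℤ - c) * dpos A v + (0ℤ - c) * dneg A v   ≡⟨ sym (srsg-row-sum srsg v) ⟩
    ∑ (sq A v)                                                            ≡⟨ ∑-sq-row A 1ℤ row-sums v ⟩
    1ℤ                                                                    ∎)
  where
  open IsSRSG srsg using (signed)
  v : Fin (suc n)
  v = zero
  row-sums : ∀ k → ∑ (A k) ≡ 1ℤ
  row-sums k = trans (row-sum≡netdeg signed k) (net-regular k)
  dpos≡3 : dpos A v ≡ + 3
  dpos≡3 = *-cancelˡ-≡ (+ 2) (dpos A v) (+ 3) (trans (2*dpos≡deg+netdeg A v) (cong₂ _+_ (regular v) (net-regular v)))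
  dneg≡2 : dneg A v ≡ + 2
  dneg≡2 = *-cancelˡ-≡ (+ 2) (dneg A v) (+ 2) (trans (2*dneg≡deg-netdeg A v) (cong₂ _-_ (regular v) (net-regular v)))
  h : ℤ
  h = proj₁ (odd-regular⇒even-order signed (+ 2) regular)
  even-order : + suc n ≡ + 2 * h
  even-order = proj₂ (odd-regular⇒even-order signed (+ 2) regular)
  expand : ∀ c h → + 2 * (c * h - + 3 * c + + 4) ≡ c * (+ 2 * h) + (+ 5 - c) + (1ℤ - c) * + 3 + (0ℤ - c) * + 2
  expand = solve-∀
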